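{- Let $q$ be a prime power with $q\not\equiv 2 \pmod 3$, and regard $\mathbb{F}_q\subseteq\mathbb{F}_{q^2},\mathbb{F}_{q^3}\subseteq\mathbb{F}_{q^6}$. Define the equivalence relation $\sim$ on $\mathbb{F}_{q^6}^\times$ by $x\sim y$ if and only if $x^{(q^2-q+1)(q-1)}=y^{(q^2-q+1)(q-1)}$, and let $\mathcal{S}=\{xy: x\in\mathbb{F}_{q^2}^\times,\ y\in\mathbb{F}_{q^3}^\times\}$. Then every equivalence class of $\sim$ contains exactly one point of the Segre variety, i.e. for every equivalence class $C$ the set $C\cap\mathcal{S}$ is nonempty and any two elements of $C\cap\mathcal{S}$ differ by a factor in $\mathbb{F}_q^\times$ (so $C\cap\mathcal{S}$ determines exactly one point of $\mathrm{PG}(5,q)$, modelled as $\mathbb{F}_{q^6}^\times/\mathbb{F}_q^\times$).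
   Context: $\mathrm{PG}(5,q)$ is modelled as the projective space of the 6-dimensional $\mathbb{F}_q$-vector space $\mathbb{F}_{q^6}$, whose points are the cosets $x\mathbb{F}_q^\times$ for $x\in\mathbb{F}_{q^6}^\times$. The set $\mathcal{S}$ (modulo $\mathbb{F}_q^\times$) is the image of the Segre embedding $\mathrm{PG}(1,q)\times\mathrm{PG}(2,q)\to\mathrm{PG}(5,q)$, called the (cubic) Segre variety. -}

module Defs where

open import Level using (Level; _⊔_; suc)
open import Data.Nat as ℕ using (ℕ; _∸_)
open import Data.Fin using (Fin)
open import Data.Product using (Σ; ∃; _×_)
open import Relation.Nullary using (¬_)
open import Relation.Binary.PropositionalEquality using (_≡_)
open import Algebra.Bundles using (CommutativeRing; Semiring)
import Algebra.Definitions.RawSemiring as RS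

record Field (c ℓ : Level) : Set (suc (c ⊔ ℓ)) where
  field
    commutativeRing : CommutativeRing c ℓ
  open CommutativeRing commutativeRing public
  field
    0≉1     : ¬ (0# ≈ 1#)
    inverse : ∀ x → ¬ (x ≈ 0#) → ∃ λ y → (x * y) ≈ 1#

  open RS (Semiring.rawSemiring semiring) public using (_^_)

record HasSize {c ℓ : Level} (F : Field c ℓ) (N : ℕ) : Set (c ⊔ ℓ) where
  open Field F
  field
    enum      : Fin N → Carrier
    enum-inj  : ∀ i j → enum i ≈ enum j → i ≡ j
    enum-surj : ∀ x → ∃ λ i → enum i ≈ x

-- Notions inside a field F of order q^6 (q the size of the prime subfield's
-- extension F_q).  The subfields F_{q^k} (k ∣ 6) of F are the sets
-- { x | x ^ (q ^ k) ≈ x }.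
module Segre {c ℓ : Level} (F : Field c ℓ) (q : ℕ) where
  open Field F

  NonZero : Carrier → Set ℓ
  NonZero x = ¬ (x ≈ 0#)

  InSubfield : ℕ → Carrier → Set ℓ
  InSubfield k x = (x ^ (q ℕ.^ k)) ≈ x

  e : ℕ
  e = ((q ℕ.^ 2 ∸ q) ℕ.+ 1) ℕ.* (q ∸ 1)

  _∼_ : Carrier → Carrier → Set ℓ
  x ∼ y = (x ^ e) ≈ (y ^ e)

  InS : Carrier → Set (c ⊔ ℓ)
  InS s = ∃ λ x → ∃ λ y →
            (InSubfield 2 x × NonZero x) × (InSubfield 3 y × NonZero y) × (s ≈ (x * y))

-- Put q = 1 + r and q⁶ − 1 = r·L·M with L = q² − q + 1 and M = (q + 1)(q² + q + 1); the exponent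
-- defining ∼ is e = r·L, and every x ≠ 0 satisfies x^(rLM) = 1 (Fermat).  Since q ≢ 2 (mod 3),
-- L and M are coprime, A·L = 1 + B·M.
-- Existence: y = x^(AL) = x·x^(BM) is ∼ x, because raising any w to the power M·k·e gives a power
-- of w^(rLM) = 1.  As y^(rM) = 1 and N + (q + 1)(q² + 1) = 1 + M, where N = q² + q + 1, the product
-- y^N · y^((q+1)(q²+1)) = y^(1+M) is ∼ y, and its factors lie in 𝔽_{q²} and 𝔽_{q³}.
-- Uniqueness: elements of 𝒮 satisfy z^(rM) = 1, so for s, t ∈ 𝒮 both ∼ x the quotient a = s/t has
-- a^(rL) = a^(rM) = 1, hence a^r = 1 by coprimality, i.e. a ∈ 𝔽_q.
module Submission where

open import Defs
open import Level using (Level)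
open import Data.Nat using (ℕ; zero; suc)
open import Data.Product using (∃; _×_; _,_; proj₁; proj₂)
open import Data.Fin as Fin using (Fin)
open import Relation.Binary.PropositionalEquality using (_≡_; _≢_)

module Exponents where
  open import Data.Nat
  open import Data.Nat.Properties using (*-assoc; m+n∸n≡m)
  open import Data.Nat.DivMod using (m≡m%n+[m/n]*n; m%n<n; [m+kn]%n≡m%n)
  open import Data.Nat.Solver using (module +-*-Solver)
  open +-*-Solver
  open import Data.Product using (∃₂; _,_)
  open import Data.Empty using (⊥-elim)
  open import Relation.Binary.PropositionalEquality

  -- For q = 1 + r:  L = q² − q + 1,  N = q² + q + 1,  M = (q + 1) N.
  L N M : ℕ → ℕ
  L r = r * suc r + 1
  N r = suc r * suc r + suc r + 1
  M r = (2 + r) * N r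

  private
    :q :L :N :M : Polynomial 1 → Polynomial 1
    :q r = con 1 :+ r
    :L r = r :* :q r :+ con 1
    :N r = :q r :* :q r :+ :q r :+ con 1
    :M r = (con 2 :+ r) :* :N r

  q²≡1+r[2+r] : ∀ r → suc r ^ 2 ≡ 1 + r * (2 + r)
  q²≡1+r[2+r] = solve 1 (λ r → :q r :^ 2 := con 1 :+ r :* (con 2 :+ r)) refl

  q³≡1+rN : ∀ r → suc r ^ 3 ≡ 1 + r * N r
  q³≡1+rN = solve 1 (λ r → :q r :^ 3 := con 1 :+ r :* :N r) refl

  q⁶≡1+rLM : ∀ r → suc r ^ 6 ≡ 1 + r * L r * M r
  q⁶≡1+rLM = solve 1 (λ r → :q r :^ 6 := con 1 :+ r :* :L r :* :M r) refl

  N+[q+1][q²+1]≡1+M : ∀ r → N r + (2 + r) * (suc r ^ 2 + 1) ≡ 1 + M r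
  N+[q+1][q²+1]≡1+M = solve 1 (λ r → :N r :+ (con 2 :+ r) :* (:q r :^ 2 :+ con 1) := con 1 :+ :M r) refl

  e≡Lr : ∀ r → (suc r ^ 2 ∸ suc r + 1) * (suc r ∸ 1) ≡ L r * r
  e≡Lr r = trans (cong (λ m → (m ∸ suc r + 1) * r) q²≡rq+q)
                 (cong (λ m → (m + 1) * r) (m+n∸n≡m (r * suc r) (suc r)))
    where
    q²≡rq+q : suc r ^ 2 ≡ r * suc r + suc r
    q²≡rq+q = solve 1 (λ r → :q r :^ 2 := r :* :q r :+ :q r) refl r

  -- The witnesses depend on r mod 6; r ≡ 1 (mod 3) is exactly q ≡ 2 (mod 3), where gcd (L, M) = 3.
  L-M-bezout : ∀ r → suc r % 3 ≢ 2 → ∃₂ λ A B → A * L r ≡ 1 + B * M r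
  L-M-bezout r = by-residue (r % 6) (r / 6) (m%n<n r 6) (m≡m%n+[m/n]*n r 6)
    where
    [i+6n]%3≡i%3 : ∀ i n → (i + n * 6) % 3 ≡ i % 3
    [i+6n]%3≡i%3 i n = subst (λ m → (i + m) % 3 ≡ i % 3) (*-assoc n 2 3) ([m+kn]%n≡m%n i (n * 2) 3)

    by-residue : ∀ {r} i n → i < 6 → r ≡ i + n * 6 → suc r % 3 ≢ 2 → ∃₂ λ A B → A * L r ≡ 1 + B * M r
    by-residue 0 n _ refl _ =
      7 + 54 * n + 162 * n ^ 2 + 180 * n ^ 3 , 1 + 7 * n + 30 * n ^ 2 ,
      solve 1 (λ n → (con 7 :+ con 54 :* n :+ con 162 :* n :^ 2 :+ con 180 :* n :^ 3) :* :L (n :* con 6)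
                     := con 1 :+ (con 1 :+ con 7 :* n :+ con 30 :* n :^ 2) :* :M (n :* con 6)) refl n
    by-residue 1 n _ refl q≢2 = ⊥-elim (q≢2 ([i+6n]%3≡i%3 2 n))
    by-residue 2 n _ refl _ =
      15 + 58 * n + 78 * n ^ 2 + 36 * n ^ 3 , 2 + 7 * n + 6 * n ^ 2 ,
      solve 1 (λ n → (con 15 :+ con 58 :* n :+ con 78 :* n :^ 2 :+ con 36 :* n :^ 3) :* :L (con 2 :+ n :* con 6)
                     := con 1 :+ (con 2 :+ con 7 :* n :+ con 6 :* n :^ 2) :* :M (con 2 :+ n :* con 6)) refl n
    by-residue 3 n _ refl _ =
      97 + 351 * n + 432 * n ^ 2 + 180 * n ^ 3 , 12 + 37 * n + 30 * n ^ 2 ,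
      solve 1 (λ n → (con 97 :+ con 351 :* n :+ con 432 :* n :^ 2 :+ con 180 :* n :^ 3) :* :L (con 3 :+ n :* con 6)
                     := con 1 :+ (con 12 :+ con 37 :* n :+ con 30 :* n :^ 2) :* :M (con 3 :+ n :* con 6)) refl n
    by-residue 4 n _ refl q≢2 = ⊥-elim (q≢2 ([i+6n]%3≡i%3 5 n))
    by-residue 5 n _ refl _ =
      68 + 163 * n + 132 * n ^ 2 + 36 * n ^ 3 , 7 + 13 * n + 6 * n ^ 2 ,
      solve 1 (λ n → (con 68 :+ con 163 :* n :+ con 132 :* n :^ 2 :+ con 36 :* n :^ 3) :* :L (con 5 :+ n :* con 6)
                     := con 1 :+ (con 7 :+ con 13 :* n :+ con 6 :* n :^ 2) :* :M (con 5 :+ n :* con 6)) refl n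
    by-residue (suc (suc (suc (suc (suc (suc _)))))) _ (s≤s (s≤s (s≤s (s≤s (s≤s (s≤s ())))))) _ _

module FieldTheory {c ℓ : Level} (F : Field c ℓ) where
  open Field F
  open import Algebra.Properties.Semiring.Exp semiring using (^-congˡ; ^-congʳ; ^-homo-*; ^-assocʳ)
  open import Algebra.Properties.CommutativeSemiring.Exp commutativeSemiring using (^-distrib-*)
  open import Algebra.Properties.CommutativeMonoid.Sum *-commutativeMonoid
    using (sum-cong-≋; sum-replicate; sum-remove; sum-permute; ∑-distrib-+) renaming (sum to ∏)
  import Data.Nat as ℕ
  import Data.Nat.Properties as ℕ
  open import Data.Fin using (_≟_)
  open import Data.Fin.Properties using (punchInᵢ≢i)
  open import Data.Fin.Permutation using (permutation)
  open import Data.Vec.Functional using (removeAt)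
  open import Relation.Nullary using (Dec; yes; no; contradiction)
  import Relation.Binary.PropositionalEquality as ≡
  open import Relation.Binary.Reasoning.Setoid setoid

  1#≉0# : 1# ≉ 0#
  1#≉0# 1≈0 = 0≉1 (sym 1≈0)

  *-cancelˡ : ∀ {x y z} → x ≉ 0# → x * y ≈ x * z → y ≈ z
  *-cancelˡ {x} {y} {z} x≉0 xy≈xz with inverse x x≉0
  ... | x⁻¹ , xx⁻¹≈1 = begin
    y               ≈⟨ *-identityˡ y ⟨
    1# * y          ≈⟨ *-congʳ x⁻¹x≈1 ⟨
    x⁻¹ * x * y     ≈⟨ *-assoc x⁻¹ x y ⟩
    x⁻¹ * (x * y)   ≈⟨ *-congˡ xy≈xz ⟩
    x⁻¹ * (x * z)   ≈⟨ *-assoc x⁻¹ x z ⟨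
    x⁻¹ * x * z     ≈⟨ *-congʳ x⁻¹x≈1 ⟩
    1# * z          ≈⟨ *-identityˡ z ⟩
    z               ∎
    where x⁻¹x≈1 = trans (*-comm x⁻¹ x) xx⁻¹≈1

  *-≉0 : ∀ {x y} → x ≉ 0# → y ≉ 0# → x * y ≉ 0#
  *-≉0 {x} x≉0 y≉0 xy≈0 = y≉0 (*-cancelˡ x≉0 (trans xy≈0 (sym (zeroʳ x))))

  ^-≉0 : ∀ {x} n → x ≉ 0# → x ^ n ≉ 0#
  ^-≉0 zero    x≉0 = 1#≉0#
  ^-≉0 (suc n) x≉0 = *-≉0 x≉0 (^-≉0 n x≉0)

  ∏-≉0 : ∀ {n} (h : Fin n → Carrier) → (∀ i → h i ≉ 0#) → ∏ h ≉ 0#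
  ∏-≉0 {zero}  h h≉0 = 1#≉0#
  ∏-≉0 {suc n} h h≉0 = *-≉0 (h≉0 Fin.zero) (∏-≉0 (λ i → h (Fin.suc i)) (λ i → h≉0 (Fin.suc i)))

  divide : ∀ s {t} → t ≉ 0# → ∃ λ a → a * t ≈ s
  divide s {t} t≉0 with inverse t t≉0
  ... | t⁻¹ , tt⁻¹≈1 = s * t⁻¹ , (begin
    s * t⁻¹ * t     ≈⟨ *-assoc s t⁻¹ t ⟩
    s * (t⁻¹ * t)   ≈⟨ *-congˡ (trans (*-comm t⁻¹ t) tt⁻¹≈1) ⟩
    s * 1#          ≈⟨ *-identityʳ s ⟩
    s               ∎)

  1^n≈1 : ∀ n → 1# ^ n ≈ 1#
  1^n≈1 zero    = refl
  1^n≈1 (suc n) = trans (*-identityˡ (1# ^ n)) (1^n≈1 n)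

  ^≈1⇒^*≈1 : ∀ {x} m k → x ^ m ≈ 1# → x ^ (m ℕ.* k) ≈ 1#
  ^≈1⇒^*≈1 {x} m k xᵐ≈1 = trans (sym (^-assocʳ x m k)) (trans (^-congˡ k xᵐ≈1) (1^n≈1 k))

  ^-periodic : ∀ {x} m → x ^ m ≈ 1# → ∀ n k → x ^ (n ℕ.+ m ℕ.* k) ≈ x ^ n
  ^-periodic {x} m xᵐ≈1 n k = begin
    x ^ (n ℕ.+ m ℕ.* k)     ≈⟨ ^-homo-* x n (m ℕ.* k) ⟩
    x ^ n * x ^ (m ℕ.* k)   ≈⟨ *-congˡ (^≈1⇒^*≈1 m k xᵐ≈1) ⟩
    x ^ n * 1#              ≈⟨ *-identityʳ (x ^ n) ⟩
    x ^ n                   ∎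

  ^≈1⇒^suc≈id : ∀ {x} n → x ^ n ≈ 1# → x ^ suc n ≈ x
  ^≈1⇒^suc≈id {x} n xⁿ≈1 = trans (*-congˡ xⁿ≈1) (*-identityʳ x)

  ^suc≈id⇒^≈1 : ∀ {x} n → x ≉ 0# → x ^ suc n ≈ x → x ^ n ≈ 1#
  ^suc≈id⇒^≈1 {x} n x≉0 xⁿ⁺¹≈x = *-cancelˡ x≉0 (trans xⁿ⁺¹≈x (sym (*-identityʳ x)))

  ^≈1-* : ∀ {x y} n → x ^ n ≈ 1# → y ^ n ≈ 1# → (x * y) ^ n ≈ 1#
  ^≈1-* {x} {y} n xⁿ≈1 yⁿ≈1 =
    trans (^-distrib-* x y n) (trans (*-cong xⁿ≈1 yⁿ≈1) (*-identityˡ 1#))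

  ^≈1-coprime : ∀ {x} m n A B → A ℕ.* m ≡ 1 ℕ.+ B ℕ.* n → x ^ m ≈ 1# → x ^ n ≈ 1# → x ≈ 1#
  ^≈1-coprime {x} m n A B Am≡1+Bn xᵐ≈1 xⁿ≈1 = begin
    x                    ≈⟨ *-identityʳ x ⟨
    x ^ 1                ≈⟨ ^-periodic n xⁿ≈1 1 B ⟨
    x ^ (1 ℕ.+ n ℕ.* B)  ≈⟨ ^-congʳ x (≡.trans (≡.cong (1 ℕ.+_) (ℕ.*-comm n B)) (≡.sym Am≡1+Bn)) ⟩
    x ^ (A ℕ.* m)        ≈⟨ ^-congʳ x (ℕ.*-comm A m) ⟩
    x ^ (m ℕ.* A)        ≈⟨ ^≈1⇒^*≈1 m A xᵐ≈1 ⟩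
    1#                   ∎

  ^≈1-quotient : ∀ {a s t} n → t ≉ 0# → a * t ≈ s → s ^ n ≈ t ^ n → a ^ n ≈ 1#
  ^≈1-quotient {a} {s} {t} n t≉0 at≈s sⁿ≈tⁿ = *-cancelˡ (^-≉0 n t≉0) (begin
    t ^ n * a ^ n    ≈⟨ *-comm (t ^ n) (a ^ n) ⟩
    a ^ n * t ^ n    ≈⟨ ^-distrib-* a t n ⟨
    (a * t) ^ n      ≈⟨ ^-congˡ n at≈s ⟩
    s ^ n            ≈⟨ sⁿ≈tⁿ ⟩
    t ^ n            ≈⟨ *-identityʳ (t ^ n) ⟨
    t ^ n * 1#       ∎)

  -- Fermat: multiplication by x ≠ 0 permutes the nonzero elements, so their product P satisfies
  -- xⁿ · P = P.  Indexed by the enumeration, P is the product over all indices with the factor at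
  -- the index of 0# replaced by 1# (punctured enum).
  module _ {n : ℕ} (size : HasSize F (suc n)) where
    open HasSize size

    private
      index : Carrier → Fin (suc n)
      index y = proj₁ (enum-surj y)

      enum-index : ∀ y → enum (index y) ≈ y
      enum-index y = proj₂ (enum-surj y)

      o : Fin (suc n)
      o = index 0#

      enum≉0 : ∀ {i} → i ≢ o → enum i ≉ 0#
      enum≉0 i≢o enumᵢ≈0 = i≢o (enum-inj _ _ (trans enumᵢ≈0 (sym (enum-index 0#))))

      punctured : (Fin (suc n) → Carrier) → Fin (suc n) → Carrier
      punctured h i with i ≟ o
      ... | yes _ = 1#
      ... | no  _ = h i

      punctured-o : ∀ h {i} → i ≡ o → punctured h i ≈ 1#
      punctured-o h {i} i≡o with i ≟ o
      ... | yes _   = refl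
      ... | no  i≢o = contradiction i≡o i≢o

      punctured-≢o : ∀ h {i} → i ≢ o → punctured h i ≈ h i
      punctured-≢o h {i} i≢o with i ≟ o
      ... | yes i≡o = contradiction i≡o i≢o
      ... | no  _   = refl

      punctured-enum≉0 : ∀ i → punctured enum i ≉ 0#
      punctured-enum≉0 i with i ≟ o
      ... | yes _   = 1#≉0#
      ... | no  i≢o = enum≉0 i≢o

      ∏-punctured-const : ∀ x → ∏ (punctured (λ _ → x)) ≈ x ^ n
      ∏-punctured-const x = begin
        ∏ (punctured (λ _ → x))                              ≈⟨ sum-remove {i = o} (punctured (λ _ → x)) ⟩
        punctured (λ _ → x) o * ∏ (removeAt (punctured (λ _ → x)) o)
          ≈⟨ *-cong (punctured-o _ ≡.refl) (sum-cong-≋ (λ j → punctured-≢o (λ _ → x) (punchInᵢ≢i o j))) ⟩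
        1# * ∏ {n} (λ _ → x)                                 ≈⟨ *-identityˡ _ ⟩
        ∏ {n} (λ _ → x)                                      ≈⟨ sum-replicate n ⟩
        x ^ n                                                ∎

      scale : Carrier → Fin (suc n) → Fin (suc n)
      scale x i = index (x * enum i)

      scale-inverse : ∀ {x y} → x * y ≈ 1# → ∀ i → scale x (scale y i) ≡ i
      scale-inverse {x} {y} xy≈1 i = enum-inj _ _ (begin
        enum (scale x (scale y i))   ≈⟨ enum-index _ ⟩
        x * enum (scale y i)         ≈⟨ *-congˡ (enum-index _) ⟩
        x * (y * enum i)             ≈⟨ *-assoc x y (enum i) ⟨
        x * y * enum i               ≈⟨ *-congʳ xy≈1 ⟩
        1# * enum i                  ≈⟨ *-identityˡ (enum i) ⟩
        enum i                       ∎)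

      punctured-scale : ∀ {x} → x ≉ 0# → ∀ i →
                        punctured enum (scale x i) ≈ punctured (λ _ → x) i * punctured enum i
      punctured-scale {x} x≉0 i = by-cases (i ≟ o)
        where
        by-cases : Dec (i ≡ o) → punctured enum (scale x i) ≈ punctured (λ _ → x) i * punctured enum i
        by-cases (yes i≡o) = begin
          punctured enum (scale x i)                 ≈⟨ punctured-o enum (enum-inj _ _ scaleᵢ≈enumₒ) ⟩
          1#                                         ≈⟨ *-identityˡ 1# ⟨
          1# * 1#                                    ≈⟨ *-cong (punctured-o _ i≡o) (punctured-o enum i≡o) ⟨
          punctured (λ _ → x) i * punctured enum i   ∎
          where
          scaleᵢ≈enumₒ : enum (scale x i) ≈ enum o
          scaleᵢ≈enumₒ = begin
            enum (scale x i)   ≈⟨ enum-index _ ⟩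
            x * enum i         ≡⟨ ≡.cong (λ j → x * enum j) i≡o ⟩
            x * enum o         ≈⟨ *-congˡ (enum-index 0#) ⟩
            x * 0#             ≈⟨ zeroʳ x ⟩
            0#                 ≈⟨ enum-index 0# ⟨
            enum o             ∎
        by-cases (no i≢o) = begin
          punctured enum (scale x i)                 ≈⟨ punctured-≢o enum scaleᵢ≢o ⟩
          enum (scale x i)                           ≈⟨ enum-index _ ⟩
          x * enum i                                 ≈⟨ *-cong (punctured-≢o _ i≢o) (punctured-≢o enum i≢o) ⟨
          punctured (λ _ → x) i * punctured enum i   ∎
          where
          scaleᵢ≢o : scale x i ≢ o
          scaleᵢ≢o scaleᵢ≡o = *-≉0 x≉0 (enum≉0 i≢o) (begin
            x * enum i         ≈⟨ enum-index _ ⟨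
            enum (scale x i)   ≡⟨ ≡.cong enum scaleᵢ≡o ⟩
            enum o             ≈⟨ enum-index 0# ⟩
            0#                 ∎)

    fermat : ∀ x → x ≉ 0# → x ^ n ≈ 1#
    fermat x x≉0 with inverse x x≉0
    ... | x⁻¹ , xx⁻¹≈1 = *-cancelˡ (∏-≉0 f punctured-enum≉0) (begin
      ∏ f * x ^ n                               ≈⟨ *-comm (∏ f) (x ^ n) ⟩
      x ^ n * ∏ f                               ≈⟨ *-congʳ (∏-punctured-const x) ⟨
      ∏ (punctured (λ _ → x)) * ∏ f             ≈⟨ ∑-distrib-+ (punctured (λ _ → x)) f ⟨
      ∏ (λ i → punctured (λ _ → x) i * f i)     ≈⟨ sum-cong-≋ (punctured-scale x≉0) ⟨
      ∏ (λ i → f (scale x i))                   ≈⟨ sum-permute f π ⟨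
      ∏ f                                       ≈⟨ *-identityʳ (∏ f) ⟨
      ∏ f * 1#                                  ∎)
      where
      f = punctured enum
      π = permutation (scale x) (scale x⁻¹) (scale-inverse xx⁻¹≈1)
                      (scale-inverse (trans (*-comm x⁻¹ x) xx⁻¹≈1))

module SegreClasses {c ℓ : Level} (F : Field c ℓ) (r : ℕ) (size : HasSize F (suc r Data.Nat.^ 6)) where
  open Field F
  open Segre F (suc r)
  open FieldTheory F
  open Exponents
  open import Algebra.Properties.Semiring.Exp semiring using (^-congˡ; ^-congʳ; ^-homo-*; ^-assocʳ)
  import Data.Nat as ℕ
  import Data.Nat.Properties as ℕ
  open import Data.Nat.Tactic.RingSolver using (solve-∀)
  import Relation.Binary.PropositionalEquality as ≡
  open import Relation.Binary.Reasoning.Setoid setoid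

  x^rLM≈1 : ∀ x → NonZero x → x ^ (r ℕ.* L r ℕ.* M r) ≈ 1#
  x^rLM≈1 = fermat (≡.subst (HasSize F) (q⁶≡1+rLM r) size)

  ^[1+kM]∼ : ∀ {y} → NonZero y → ∀ k → (y ^ (1 ℕ.+ k ℕ.* M r)) ∼ y
  ^[1+kM]∼ {y} y≉0 k = begin
    (y ^ (1 ℕ.+ k ℕ.* M r)) ^ e               ≈⟨ ^-assocʳ y (1 ℕ.+ k ℕ.* M r) e ⟩
    y ^ ((1 ℕ.+ k ℕ.* M r) ℕ.* e)             ≡⟨ ≡.cong (λ m → y ^ ((1 ℕ.+ k ℕ.* M r) ℕ.* m)) (e≡Lr r) ⟩
    y ^ ((1 ℕ.+ k ℕ.* M r) ℕ.* (L r ℕ.* r))   ≡⟨ ≡.cong (y ^_) ([1+kM]Lr≡Lr+rLMk k (M r) (L r) r) ⟩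
    y ^ (L r ℕ.* r ℕ.+ r ℕ.* L r ℕ.* M r ℕ.* k)
      ≈⟨ ^-periodic (r ℕ.* L r ℕ.* M r) (x^rLM≈1 y y≉0) (L r ℕ.* r) k ⟩
    y ^ (L r ℕ.* r)                           ≡⟨ ≡.cong (y ^_) (e≡Lr r) ⟨
    y ^ e                                     ∎
    where
    [1+kM]Lr≡Lr+rLMk : ∀ k M L r → (1 ℕ.+ k ℕ.* M) ℕ.* (L ℕ.* r) ≡ L ℕ.* r ℕ.+ r ℕ.* L ℕ.* M ℕ.* k
    [1+kM]Lr≡Lr+rLMk = solve-∀

  ^≈1⇒InSubfield : ∀ k {d z} → suc r ℕ.^ k ≡ suc d → z ^ d ≈ 1# → InSubfield k z
  ^≈1⇒InSubfield k {d} {z} qᵏ≡1+d zᵈ≈1 = trans (^-congʳ z qᵏ≡1+d) (^≈1⇒^suc≈id d zᵈ≈1)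

  InSubfield⇒^≈1 : ∀ k {d z} → suc r ℕ.^ k ≡ suc d → NonZero z → InSubfield k z → z ^ d ≈ 1#
  InSubfield⇒^≈1 k {d} {z} qᵏ≡1+d z≉0 z∈𝔽 =
    ^suc≈id⇒^≈1 d z≉0 (trans (^-congʳ z (≡.sym qᵏ≡1+d)) z∈𝔽)

  InS⇒NonZero : ∀ {s} → InS s → NonZero s
  InS⇒NonZero (x , y , (_ , x≉0) , (_ , y≉0) , s≈xy) s≈0 = *-≉0 x≉0 y≉0 (trans (sym s≈xy) s≈0)

  InS⇒^rM≈1 : ∀ {s} → InS s → s ^ (r ℕ.* M r) ≈ 1#
  InS⇒^rM≈1 {s} (x , y , (x∈𝔽q² , x≉0) , (y∈𝔽q³ , y≉0) , s≈xy) = begin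
    s ^ (r ℕ.* M r)                ≈⟨ ^-congˡ (r ℕ.* M r) s≈xy ⟩
    (x * y) ^ (r ℕ.* M r)          ≈⟨ ^≈1-* (r ℕ.* M r) xʳᴹ≈1 yʳᴹ≈1 ⟩
    1#                             ∎
    where
    r[aN]≡raN : ∀ r a N → r ℕ.* (a ℕ.* N) ≡ r ℕ.* a ℕ.* N
    r[aN]≡raN = solve-∀
    r[aN]≡rNa : ∀ r a N → r ℕ.* (a ℕ.* N) ≡ r ℕ.* N ℕ.* a
    r[aN]≡rNa = solve-∀
    xʳᴹ≈1 : x ^ (r ℕ.* M r) ≈ 1#
    xʳᴹ≈1 = trans (^-congʳ x (r[aN]≡raN r (2 ℕ.+ r) (N r)))
                  (^≈1⇒^*≈1 (r ℕ.* (2 ℕ.+ r)) (N r) (InSubfield⇒^≈1 2 (q²≡1+r[2+r] r) x≉0 x∈𝔽q²))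
    yʳᴹ≈1 : y ^ (r ℕ.* M r) ≈ 1#
    yʳᴹ≈1 = trans (^-congʳ y (r[aN]≡rNa r (2 ℕ.+ r) (N r)))
                  (^≈1⇒^*≈1 (r ℕ.* N r) (2 ℕ.+ r) (InSubfield⇒^≈1 3 (q³≡1+rN r) y≉0 y∈𝔽q³))

  module _ (A B : ℕ) (bezout : A ℕ.* L r ≡ 1 ℕ.+ B ℕ.* M r) where

    𝒮∩class-nonempty : ∀ x → NonZero x → ∃ λ s → InS s × (s ∼ x)
    𝒮∩class-nonempty x x≉0 =
      y₁ * y₂ , (y₁ , y₂ , (y₁∈𝔽q² , ^-≉0 (N r) y≉0) , (y₂∈𝔽q³ , ^-≉0 (a ℕ.* b) y≉0) , refl) , y₁y₂∼x
      where
      y = x ^ (A ℕ.* L r)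
      y≉0 : NonZero y
      y≉0 = ^-≉0 (A ℕ.* L r) x≉0
      y∼x : y ∼ x
      y∼x = trans (^-congˡ e (^-congʳ x bezout)) (^[1+kM]∼ x≉0 B)
      yʳᴹ≈1 : y ^ (r ℕ.* M r) ≈ 1#
      yʳᴹ≈1 = trans (^-assocʳ x (A ℕ.* L r) (r ℕ.* M r))
                    (trans (^-congʳ x (AL[rM]≡rLMA A (L r) r (M r)))
                           (^≈1⇒^*≈1 (r ℕ.* L r ℕ.* M r) A (x^rLM≈1 x x≉0)))
        where
        AL[rM]≡rLMA : ∀ A L r M → A ℕ.* L ℕ.* (r ℕ.* M) ≡ r ℕ.* L ℕ.* M ℕ.* A
        AL[rM]≡rLMA = solve-∀
      a = 2 ℕ.+ r
      b = suc r ℕ.^ 2 ℕ.+ 1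
      y₁ = y ^ N r
      y₂ = y ^ (a ℕ.* b)
      y₁∈𝔽q² : InSubfield 2 y₁
      y₁∈𝔽q² = ^≈1⇒InSubfield 2 (q²≡1+r[2+r] r)
        (trans (^-assocʳ y (N r) (r ℕ.* a))
               (trans (^-congʳ y (N[ra]≡r[aN]*1 (N r) r a)) (^≈1⇒^*≈1 (r ℕ.* M r) 1 yʳᴹ≈1)))
        where
        N[ra]≡r[aN]*1 : ∀ N r a → N ℕ.* (r ℕ.* a) ≡ r ℕ.* (a ℕ.* N) ℕ.* 1
        N[ra]≡r[aN]*1 = solve-∀
      y₂∈𝔽q³ : InSubfield 3 y₂
      y₂∈𝔽q³ = ^≈1⇒InSubfield 3 (q³≡1+rN r)
        (trans (^-assocʳ y (a ℕ.* b) (r ℕ.* N r))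
               (trans (^-congʳ y (ab[rN]≡r[aN]b a b r (N r))) (^≈1⇒^*≈1 (r ℕ.* M r) b yʳᴹ≈1)))
        where
        ab[rN]≡r[aN]b : ∀ a b r N → a ℕ.* b ℕ.* (r ℕ.* N) ≡ r ℕ.* (a ℕ.* N) ℕ.* b
        ab[rN]≡r[aN]b = solve-∀
      y₁y₂∼x : (y₁ * y₂) ∼ x
      y₁y₂∼x = begin
        (y₁ * y₂) ^ e                 ≈⟨ ^-congˡ e (^-homo-* y (N r) (a ℕ.* b)) ⟨
        (y ^ (N r ℕ.+ a ℕ.* b)) ^ e   ≡⟨ ≡.cong (λ m → (y ^ m) ^ e) N+ab≡1+1*M ⟩
        (y ^ (1 ℕ.+ 1 ℕ.* M r)) ^ e   ≈⟨ ^[1+kM]∼ y≉0 1 ⟩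
        y ^ e                         ≈⟨ y∼x ⟩
        x ^ e                         ∎
        where
        N+ab≡1+1*M : N r ℕ.+ a ℕ.* b ≡ 1 ℕ.+ 1 ℕ.* M r
        N+ab≡1+1*M = ≡.trans (N+[q+1][q²+1]≡1+M r) (≡.cong suc (≡.sym (ℕ.*-identityˡ (M r))))

    𝒮∩class-proportional : ∀ x s t → InS s → InS t → s ∼ x → t ∼ x →
                           ∃ λ a → InSubfield 1 a × NonZero a × (s ≈ (a * t))
    𝒮∩class-proportional x s t s∈𝒮 t∈𝒮 s∼x t∼x with divide s (InS⇒NonZero t∈𝒮)
    ... | a , at≈s = a , a∈𝔽q , a≉0 , sym at≈s
      where
      t≉0 = InS⇒NonZero t∈𝒮
      a≉0 : NonZero a
      a≉0 a≈0 = InS⇒NonZero s∈𝒮 (trans (sym at≈s) (trans (*-congʳ a≈0) (zeroˡ t)))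
      aᵉ≈1 : a ^ e ≈ 1#
      aᵉ≈1 = ^≈1-quotient e t≉0 at≈s (trans s∼x (sym t∼x))
      aʳᴹ≈1 : a ^ (r ℕ.* M r) ≈ 1#
      aʳᴹ≈1 = ^≈1-quotient (r ℕ.* M r) t≉0 at≈s (trans (InS⇒^rM≈1 s∈𝒮) (sym (InS⇒^rM≈1 t∈𝒮)))
      aʳ≈1 : a ^ r ≈ 1#
      aʳ≈1 = ^≈1-coprime (L r) (M r) A B bezout
        (trans (^-assocʳ a r (L r)) (trans (^-congʳ a (≡.trans (ℕ.*-comm r (L r)) (≡.sym (e≡Lr r)))) aᵉ≈1))
        (trans (^-assocʳ a r (M r)) aʳᴹ≈1)
      a∈𝔽q : InSubfield 1 a
      a∈𝔽q = ^≈1⇒InSubfield 1 (ℕ.*-identityʳ (suc r)) aʳ≈1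

open import Data.Nat using (_≥_; _^_; _%_)
open import Data.Nat.Primality using (Prime)

mainTheorem2 : ∀ {c ℓ : Level} (p k q : ℕ) → Prime p → k ≥ 1 → q ≡ p ^ k → q % 3 ≢ 2 →
    (F : Field c ℓ) → HasSize F (q ^ 6) →
    let open Field F
        open Segre F q
    in ∀ x → NonZero x →
         (∃ λ s → InS s × (s ∼ x))
         × (∀ s t → InS s → InS t → s ∼ x → t ∼ x →
              ∃ λ a → InSubfield 1 a × NonZero a × (s ≈ (a * t)))
mainTheorem2 p k zero _ _ _ _ F size with HasSize.enum-surj size (Field.0# F)
... | () , _
mainTheorem2 p k (suc r) _ _ _ q≢2 F size with Exponents.L-M-bezout r q≢2
... | A , B , bezout = λ x x≉0 →
  𝒮∩class-nonempty A B bezout x x≉0 , 𝒮∩class-proportional A B bezout x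
  where open SegreClasses F r size
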